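{- Let $M=\{1^{p_1},2^{p_2},\dots,n^{p_n}\}$ with $p_1,\dots,p_n$ positive integers. Then $$\sum_{T\in\mathcal{T}_M}x^{\mathsf{even}(T)}y^{\mathsf{oo}(T)+\mathsf{el}(T)}z^{\mathsf{ee}(T)}=\sum_{T\in\mathcal{T}_M}x^{\mathsf{oo}(T)+\mathsf{el}(T)}y^{\mathsf{even}(T)}z^{\mathsf{ee}(T)}.$$
   Context: A plane tree is a rooted tree in which the children of every node are linearly ordered. With $p=\sum p_i$, a weakly increasing tree on $M$ is a plane tree with $p+1$ nodes labeled by the elements of the multiset $M\cup\{0\}$ (with multiplicity) such that labels weakly increase along every root-to-leaf path and the labels of the children of each node weakly increase from left to right. $\mathcal{T}_M$ is the set of such trees. The degree of a node is its number of children; its level is its distance from the root (root at level $0$). $\mathsf{even}(T)$ is the number of even-degree nodes; $\mathsf{oo}(T)$ the number of odd-degree nodes on odd levels; $\mathsf{el}(T)$ the number of nodes on even levels; $\mathsf{ee}(T)$ the number of even-degree nodes on even levels. -}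

module Defs where

open import Data.Nat using (ℕ; zero; suc; _+_; _≤ᵇ_; _≡ᵇ_)
open import Data.Fin using (Fin; zero; suc)
open import Data.Bool using (Bool; true; false; _∧_; if_then_else_)
open import Data.List using (List; []; _∷_; length; upTo)
open import Data.Bool using (T; not)
open import Data.Product using (Σ; _×_)
open import Relation.Binary.PropositionalEquality using (_≡_)

data Tree : Set where
  node : ℕ → List Tree → Tree

label : Tree → ℕ
label (node a _) = a

childrenAbove : ℕ → List Tree → Bool
childrenAbove a []       = true
childrenAbove a (t ∷ ts) = (a ≤ᵇ label t) ∧ childrenAbove a ts

sortedLabels : List Tree → Bool
sortedLabels []                = true
sortedLabels (t ∷ [])          = true
sortedLabels (t ∷ (u ∷ us))    = (label t ≤ᵇ label u) ∧ sortedLabels (u ∷ us)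

mutual
  weaklyIncreasing : Tree → Bool
  weaklyIncreasing (node a ts) =
    childrenAbove a ts ∧ sortedLabels ts ∧ weaklyIncreasingF ts

  weaklyIncreasingF : List Tree → Bool
  weaklyIncreasingF []       = true
  weaklyIncreasingF (t ∷ ts) = weaklyIncreasing t ∧ weaklyIncreasingF ts

mutual
  countLabel : ℕ → Tree → ℕ
  countLabel ℓ (node a ts) = (if a ≡ᵇ ℓ then 1 else 0) + countLabelF ℓ ts

  countLabelF : ℕ → List Tree → ℕ
  countLabelF ℓ []       = 0
  countLabelF ℓ (t ∷ ts) = countLabel ℓ t + countLabelF ℓ ts

mutual
  labelsBelow : ℕ → Tree → Bool
  labelsBelow n (node a ts) = (a ≤ᵇ n) ∧ labelsBelowF n ts

  labelsBelowF : ℕ → List Tree → Bool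
  labelsBelowF n []       = true
  labelsBelowF n (t ∷ ts) = labelsBelow n t ∧ labelsBelowF n ts

-- multiplicity of label k+1 in M = {1^{p_1},…,n^{p_n}}
-- (p is 0-indexed: p i is the multiplicity of label i+1; labels > n get 0)
pAt : (n : ℕ) → (Fin n → ℕ) → ℕ → ℕ
pAt zero    p k       = 0
pAt (suc n) p zero    = p zero
pAt (suc n) p (suc k) = pAt n (λ i → p (suc i)) k

-- multiplicity of label ℓ in the multiset M ∪ {0}
multiplicity : (n : ℕ) → (Fin n → ℕ) → ℕ → ℕ
multiplicity n p zero    = 1
multiplicity n p (suc k) = pAt n p k

allB : (ℕ → Bool) → List ℕ → Bool
allB f []       = true
allB f (x ∷ xs) = f x ∧ allB f xs

-- T ∈ 𝒯_M : weakly increasing, and its multiset of labels is exactly M ∪ {0}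
-- (all labels lie in {0,…,n} and each ℓ ∈ {0,…,n} occurs with the right
-- multiplicity; this also forces the node count to be p+1)
inTM : (n : ℕ) → (Fin n → ℕ) → Tree → Bool
inTM n p t =
  weaklyIncreasing t ∧ labelsBelow n t
  ∧ allB (λ ℓ → countLabel ℓ t ≡ᵇ multiplicity n p ℓ) (upTo (suc n))

degree : Tree → ℕ
degree (node _ ts) = length ts

isEven : ℕ → Bool
isEven zero          = true
isEven (suc zero)    = false
isEven (suc (suc k)) = isEven k

b2n : Bool → ℕ
b2n true  = 1
b2n false = 0

-- Each statistic is computed with a flag saying whether the current node
-- lies on an even level; the root is on level 0 (even).
mutual
  evenSt : Tree → ℕ
  evenSt (node a ts) = b2n (isEven (length ts)) + evenStF ts

  evenStF : List Tree → ℕ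
  evenStF []       = 0
  evenStF (t ∷ ts) = evenSt t + evenStF ts

mutual
  ooAt : Bool → Tree → ℕ
  ooAt lev (node a ts) =
    b2n (not lev ∧ not (isEven (length ts))) + ooAtF (not lev) ts

  ooAtF : Bool → List Tree → ℕ
  ooAtF lev []       = 0
  ooAtF lev (t ∷ ts) = ooAt lev t + ooAtF lev ts

mutual
  elAt : Bool → Tree → ℕ
  elAt lev (node a ts) = b2n lev + elAtF (not lev) ts

  elAtF : Bool → List Tree → ℕ
  elAtF lev []       = 0
  elAtF lev (t ∷ ts) = elAt lev t + elAtF lev ts

mutual
  eeAt : Bool → Tree → ℕ
  eeAt lev (node a ts) = b2n (lev ∧ isEven (length ts)) + eeAtF (not lev) ts

  eeAtF : Bool → List Tree → ℕ
  eeAtF lev []       = 0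
  eeAtF lev (t ∷ ts) = eeAt lev t + eeAtF lev ts

even oo el ee : Tree → ℕ
even = evenSt
oo   = ooAt true
el   = elAt true
ee   = eeAt true

-- Coefficient classes of the two generating polynomials.
-- LHS: Σ_T x^{even} y^{oo+el} z^{ee}; its coefficient of x^a y^b z^c is the
-- number of elements of LHSClass n p a b c.
LHSClass : (n : ℕ) → (Fin n → ℕ) → ℕ → ℕ → ℕ → Set
LHSClass n p a b c =
  Σ Tree λ t → T (inTM n p t) × (even t ≡ a) × (oo t + el t ≡ b) × (ee t ≡ c)

RHSClass : (n : ℕ) → (Fin n → ℕ) → ℕ → ℕ → ℕ → Set
RHSClass n p a b c =
  Σ Tree λ t → T (inTM n p t) × (oo t + el t ≡ a) × (even t ≡ b) × (ee t ≡ c)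

{-# OPTIONS --safe #-}
-- Count nodes by the parities of their level and degree: ee, oe, eo, oo, and
-- let odd = eo + oo.  Then even = ee + oe and oo + el = ee + odd.  An
-- involution ψ, acting on the child forest of the root, satisfies
-- oe (ψ T) = odd T.  Applied to ψ T this gives odd (ψ T) = oe T, and since ψ
-- preserves the number of nodes ee + oe + odd, also ee (ψ T) = ee T; so ψ swaps
-- even with oo + el and fixes ee.  At some nodes ψ exchanges the children of a
-- node with its younger siblings.  These are the two subtrees of the node in
-- the first-child/next-sibling binary tree, whose heap order is exactly the
-- weak increase of the plane tree, so ψ preserves weak increase and the
-- multiset of labels.
module Submission where

open import Defs
open import Data.Nat using (ℕ; zero; suc; _+_; _≤_; _≤ᵇ_; _≡ᵇ_)
open import Data.Nat.Properties
  using (≤ᵇ⇒≤; ≤⇒≤ᵇ; ≤-trans; +-assoc; +-comm; +-identityʳ; +-cancelʳ-≡;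
         ≡-irrelevant; +-isCommutativeSemigroup)
open import Data.Nat.Tactic.RingSolver using (solve-∀; solve)
open import Data.Bool using (Bool; true; false; not; _∧_; _xor_; if_then_else_; T)
open import Data.Bool.Properties
  using (not-involutive; T-∧; T-irrelevant; ∧-isCommutativeMonoid)
open import Data.Fin using (Fin)
open import Data.List using (List; []; _∷_; length; upTo)
open import Data.Product using (Σ; _×_; _,_; proj₁)
open import Data.Product.Properties using (Σ-≡,≡→≡)
open import Data.Unit using (⊤; tt)
open import Function.Bundles using (_↔_; mk↔ₛ′; Equivalence)
open import Algebra.Structures using (IsCommutativeSemigroup; IsCommutativeMonoid)
open import Relation.Nullary using (Irrelevant)
open import Relation.Binary.PropositionalEquality

∧-intro : ∀ {x y} → T x → T y → T (x ∧ y)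
∧-intro p q = Equivalence.from T-∧ (p , q)

∧-elim : ∀ {x y} → T (x ∧ y) → T x × T y
∧-elim = Equivalence.to T-∧

evenLength : {A : Set} → List A → Bool
evenLength []       = true
evenLength (_ ∷ xs) = not (evenLength xs)

isEven-suc : ∀ n → isEven (suc n) ≡ not (isEven n)
isEven-suc zero    = refl
isEven-suc (suc n) = sym (trans (cong not (isEven-suc n)) (not-involutive (isEven n)))

evenLength≡isEven∘length : {A : Set} (xs : List A) → evenLength xs ≡ isEven (length xs)
evenLength≡isEven∘length []       = refl
evenLength≡isEven∘length (_ ∷ xs) =
  trans (cong not (evenLength≡isEven∘length xs)) (sym (isEven-suc (length xs)))

-- In the first-child/next-sibling binary tree of a forest, node a c ∷ s is a
-- node with subtrees c and s; swap exchanges them.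
infix 4 _≈_

data _≈_ : List Tree → List Tree → Set where
  []   : [] ≈ []
  keep : ∀ {a c s c′ s′} → c ≈ c′ → s ≈ s′ → node a c ∷ s ≈ node a c′ ∷ s′
  swap : ∀ {a c s c′ s′} → c ≈ s′ → s ≈ c′ → node a c ∷ s ≈ node a c′ ∷ s′

FoldsLabels : {A : Set} → (A → A → A) → (ℕ → A) → (List Tree → A) → Set
FoldsLabels _∙_ g F = ∀ a cs ts → F (node a cs ∷ ts) ≡ (g a ∙ F cs) ∙ F ts

module _ {A : Set} {_∙_ : A → A → A} (isCS : IsCommutativeSemigroup _≡_ _∙_) where
  open IsCommutativeSemigroup isCS using (assoc; comm)

  foldsLabels-≈ : ∀ {g F} → FoldsLabels _∙_ g F → ∀ {ts us} → ts ≈ us → F ts ≡ F us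
  foldsLabels-≈ F-cons [] = refl
  foldsLabels-≈ {g} {F} F-cons (keep {a} {c} {s} {c′} {s′} c≈ s≈) = begin
    F (node a c ∷ s)       ≡⟨ F-cons a c s ⟩
    (g a ∙ F c) ∙ F s      ≡⟨ cong₂ (λ x y → (g a ∙ x) ∙ y) (foldsLabels-≈ F-cons c≈) (foldsLabels-≈ F-cons s≈) ⟩
    (g a ∙ F c′) ∙ F s′    ≡⟨ sym (F-cons a c′ s′) ⟩
    F (node a c′ ∷ s′)     ∎
    where open ≡-Reasoning
  foldsLabels-≈ {g} {F} F-cons (swap {a} {c} {s} {c′} {s′} c≈ s≈) = begin
    F (node a c ∷ s)       ≡⟨ F-cons a c s ⟩
    (g a ∙ F c) ∙ F s      ≡⟨ assoc (g a) (F c) (F s) ⟩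
    g a ∙ (F c ∙ F s)      ≡⟨ cong (g a ∙_) (comm (F c) (F s)) ⟩
    g a ∙ (F s ∙ F c)      ≡⟨ sym (assoc (g a) (F s) (F c)) ⟩
    (g a ∙ F s) ∙ F c      ≡⟨ cong₂ (λ x y → (g a ∙ x) ∙ y) (foldsLabels-≈ F-cons s≈) (foldsLabels-≈ F-cons c≈) ⟩
    (g a ∙ F c′) ∙ F s′    ≡⟨ sym (F-cons a c′ s′) ⟩
    F (node a c′ ∷ s′)     ∎
    where open ≡-Reasoning

-- Heap order of the first-child/next-sibling binary tree of a forest below a
-- node labelled a.
Heap : ℕ → List Tree → Set
Heap a []             = ⊤
Heap a (node b c ∷ s) = a ≤ b × Heap b c × Heap b s

Heap-≈ : ∀ {a ts us} → ts ≈ us → Heap a ts → Heap a us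
Heap-≈ []         h                 = h
Heap-≈ (keep c s) (a≤b , hc , hs) = a≤b , Heap-≈ c hc , Heap-≈ s hs
Heap-≈ (swap c s) (a≤b , hc , hs) = a≤b , Heap-≈ s hs , Heap-≈ c hc

childrenAbove-≤ : ∀ {a b} ts → a ≤ b → T (childrenAbove b ts) → T (childrenAbove a ts)
childrenAbove-≤ []       a≤b _     = tt
childrenAbove-≤ {a} {b} (t ∷ ts) a≤b above =
  let (b≤t , rest) = ∧-elim {b ≤ᵇ label t} above
  in ∧-intro (≤⇒≤ᵇ (≤-trans a≤b (≤ᵇ⇒≤ b (label t) b≤t))) (childrenAbove-≤ ts a≤b rest)

sortedLabels-∷⁻ : ∀ t ts → T (sortedLabels (t ∷ ts)) →
                  T (childrenAbove (label t) ts) × T (sortedLabels ts)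
sortedLabels-∷⁻ t []       _      = tt , tt
sortedLabels-∷⁻ t (u ∷ us) sorted =
  let (t≤u , u-sorted) = ∧-elim {label t ≤ᵇ label u} sorted
      (u-below , _)    = sortedLabels-∷⁻ u us u-sorted
  in ∧-intro t≤u (childrenAbove-≤ us (≤ᵇ⇒≤ _ _ t≤u) u-below) , u-sorted

sortedLabels-∷⁺ : ∀ t ts → T (childrenAbove (label t) ts) → T (sortedLabels ts) →
                  T (sortedLabels (t ∷ ts))
sortedLabels-∷⁺ t []       _     _      = tt
sortedLabels-∷⁺ t (u ∷ us) above sorted = ∧-intro (proj₁ (∧-elim {label t ≤ᵇ label u} above)) sorted

increasing⇒Heap : ∀ a ts → T (weaklyIncreasing (node a ts)) → Heap a ts
increasing⇒Heap a []               _ = tt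
increasing⇒Heap a (node b cs ∷ ts) h =
  let (above , sorted-incr)  = ∧-elim {childrenAbove a (node b cs ∷ ts)} h
      (sorted , incr)        = ∧-elim {sortedLabels (node b cs ∷ ts)} sorted-incr
      (ts-above , ts-sorted) = sortedLabels-∷⁻ (node b cs) ts sorted
      (cs-incr , ts-incr)    = ∧-elim {weaklyIncreasing (node b cs)} incr
  in ≤ᵇ⇒≤ a b (proj₁ (∧-elim {a ≤ᵇ b} above)) ,
     increasing⇒Heap b cs cs-incr ,
     increasing⇒Heap b ts (∧-intro ts-above (∧-intro ts-sorted ts-incr))

Heap⇒increasing : ∀ a ts → Heap a ts → T (weaklyIncreasing (node a ts))
Heap⇒increasing a []               _                         = tt
Heap⇒increasing a (node b cs ∷ ts) (a≤b , cs-heap , ts-heap) =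
  let (ts-above , sorted-incr) = ∧-elim {childrenAbove b ts} (Heap⇒increasing b ts ts-heap)
      (ts-sorted , ts-incr)    = ∧-elim {sortedLabels ts} sorted-incr
  in ∧-intro (∧-intro (≤⇒≤ᵇ a≤b) (childrenAbove-≤ ts a≤b ts-above))
             (∧-intro (sortedLabels-∷⁺ (node b cs) ts ts-above ts-sorted)
                      (∧-intro (Heap⇒increasing b cs cs-heap) ts-incr))

-- φ acts on a forest whose trees lie on odd levels, φ↓ on one whose trees lie
-- on even levels.
mutual
  φ : List Tree → List Tree
  φ [] = []
  φ (node w F ∷ []) =
    if evenLength F
    then node w (φ↓ F) ∷ []
    else node w [] ∷ φ⇄ F
  φ (node w F₁ ∷ node w₂ F₂ ∷ R) =
    if evenLength F₁ xor evenLength F₂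
    then node w (φ↓ F₁) ∷ node w₂ (φ↓ F₂) ∷ φ R
    else node w (node w₂ (φ R) ∷ φ↓ F₂) ∷ φ⇄ F₁

  φ↓ : List Tree → List Tree
  φ↓ []             = []
  φ↓ (node a C ∷ S) = node a (φ C) ∷ φ↓ S

  φ⇄ : List Tree → List Tree
  φ⇄ []             = []
  φ⇄ (node a C ∷ S) = node a (φ↓ S) ∷ φ C

evenLength-φ↓ : ∀ F → evenLength (φ↓ F) ≡ evenLength F
evenLength-φ↓ []             = refl
evenLength-φ↓ (node _ _ ∷ F) = cong not (evenLength-φ↓ F)

mutual
  φ-involutive : ∀ ts → φ (φ ts) ≡ ts
  φ-involutive [] = refl
  φ-involutive (node w [] ∷ []) = refl
  φ-involutive (node w (node u C ∷ G) ∷ []) with evenLength G in e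
  ... | true  rewrite evenLength-φ↓ G | e | φ-involutive C | φ↓-involutive G = refl
  ... | false rewrite evenLength-φ↓ G | e | φ-involutive C | φ↓-involutive G = refl
  φ-involutive (node w [] ∷ node w₂ F₂ ∷ R) with evenLength F₂ in e
  ... | true  rewrite evenLength-φ↓ F₂ | e | φ-involutive R | φ↓-involutive F₂ = refl
  ... | false rewrite evenLength-φ↓ F₂ | e | φ-involutive R | φ↓-involutive F₂ = refl
  φ-involutive (node w (node a C ∷ G) ∷ node w₂ F₂ ∷ R)
    with evenLength G in e₁ | evenLength F₂ in e₂
  ... | true  | true  rewrite evenLength-φ↓ G | evenLength-φ↓ F₂ | e₁ | e₂
                            | φ-involutive C | φ↓-involutive G
                            | φ-involutive R | φ↓-involutive F₂ = refl
  ... | true  | false rewrite evenLength-φ↓ G | evenLength-φ↓ F₂ | e₁ | e₂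
                            | φ-involutive C | φ↓-involutive G
                            | φ-involutive R | φ↓-involutive F₂ = refl
  ... | false | true  rewrite evenLength-φ↓ G | evenLength-φ↓ F₂ | e₁ | e₂
                            | φ-involutive C | φ↓-involutive G
                            | φ-involutive R | φ↓-involutive F₂ = refl
  ... | false | false rewrite evenLength-φ↓ G | evenLength-φ↓ F₂ | e₁ | e₂
                            | φ-involutive C | φ↓-involutive G
                            | φ-involutive R | φ↓-involutive F₂ = refl

  φ↓-involutive : ∀ F → φ↓ (φ↓ F) ≡ F
  φ↓-involutive []             = refl
  φ↓-involutive (node a C ∷ S) = cong₂ (λ c s → node a c ∷ s) (φ-involutive C) (φ↓-involutive S)

mutual
  φ-≈ : ∀ ts → ts ≈ φ ts
  φ-≈ [] = []
  φ-≈ (node w F ∷ []) with evenLength F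
  ... | true  = keep (φ↓-≈ F) []
  ... | false = swap (φ⇄-≈ F) []
  φ-≈ (node w F₁ ∷ node w₂ F₂ ∷ R) with evenLength F₁ xor evenLength F₂
  ... | true  = keep (φ↓-≈ F₁) (keep (φ↓-≈ F₂) (φ-≈ R))
  ... | false = swap (φ⇄-≈ F₁) (swap (φ↓-≈ F₂) (φ-≈ R))

  φ↓-≈ : ∀ F → F ≈ φ↓ F
  φ↓-≈ []             = []
  φ↓-≈ (node a C ∷ S) = keep (φ-≈ C) (φ↓-≈ S)

  φ⇄-≈ : ∀ F → F ≈ φ⇄ F
  φ⇄-≈ []             = []
  φ⇄-≈ (node a C ∷ S) = swap (φ-≈ C) (φ↓-≈ S)

-- A weight of a node depends on whether its level is even and whether its
-- degree is even.
Weight : Set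
Weight = Bool → Bool → ℕ

weigh : Weight → Bool → List Tree → ℕ
weigh w l []             = 0
weigh w l (node a c ∷ s) = (w l (evenLength c) + weigh w (not l) c) + weigh w l s

-- The total weight of a tree whose root has child forest ts.
weighTree : Weight → List Tree → ℕ
weighTree w ts = w true (evenLength ts) + weigh w false ts

_⊕_ : Weight → Weight → Weight
(v ⊕ w) l d = v l d + w l d

weigh-⊕ : ∀ v w l ts → weigh (v ⊕ w) l ts ≡ weigh v l ts + weigh w l ts
weigh-⊕ v w l []             = refl
weigh-⊕ v w l (node a c ∷ s)
  rewrite weigh-⊕ v w (not l) c | weigh-⊕ v w l s =
    interchange (v l (evenLength c)) (w l (evenLength c))
                (weigh v (not l) c) (weigh w (not l) c) (weigh v l s) (weigh w l s)
  where
  interchange : ∀ x y x′ y′ x″ y″ →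
    ((x + y) + (x′ + y′)) + (x″ + y″) ≡ ((x + x′) + x″) + ((y + y′) + y″)
  interchange = solve-∀

weigh-cong : ∀ {v w} → (∀ l d → v l d ≡ w l d) → ∀ l ts → weigh v l ts ≡ weigh w l ts
weigh-cong v≗w l []             = refl
weigh-cong v≗w l (node a c ∷ s) =
  cong₂ _+_ (cong₂ _+_ (v≗w l (evenLength c)) (weigh-cong v≗w (not l) c)) (weigh-cong v≗w l s)

weighTree-⊕ : ∀ v w ts → weighTree (v ⊕ w) ts ≡ weighTree v ts + weighTree w ts
weighTree-⊕ v w ts rewrite weigh-⊕ v w false ts =
  interchange (v true (evenLength ts)) (w true (evenLength ts)) (weigh v false ts) (weigh w false ts)
  where
  interchange : ∀ x y x′ y′ → (x + y) + (x′ + y′) ≡ (x + x′) + (y + y′)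
  interchange = solve-∀

weighTree-cong : ∀ {v w} → (∀ l d → v l d ≡ w l d) → ∀ ts → weighTree v ts ≡ weighTree w ts
weighTree-cong v≗w ts = cong₂ _+_ (v≗w true (evenLength ts)) (weigh-cong v≗w false ts)

even-node odd-node ee-node oe-node oo-node el-node any-node : Weight
even-node _ d = b2n d
odd-node  _ d = b2n (not d)
ee-node   l d = b2n (l ∧ d)
oe-node   l d = b2n (not l ∧ d)
oo-node   l d = b2n (not l ∧ not d)
el-node   l _ = b2n l
any-node  _ _ = 1

≗-by-cases : ∀ (v w : Weight) →
  v true true ≡ w true true → v true false ≡ w true false →
  v false true ≡ w false true → v false false ≡ w false false → ∀ l d → v l d ≡ w l d
≗-by-cases _ _ TT TF FT FF true  true  = TT
≗-by-cases _ _ TT TF FT FF true  false = TF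
≗-by-cases _ _ TT TF FT FF false true  = FT
≗-by-cases _ _ TT TF FT FF false false = FF

weighTree-even : ∀ ts → weighTree even-node ts ≡ weighTree ee-node ts + weighTree oe-node ts
weighTree-even ts =
  trans (weighTree-cong (≗-by-cases even-node (ee-node ⊕ oe-node) refl refl refl refl) ts)
        (weighTree-⊕ ee-node oe-node ts)

weighTree-ooel : ∀ ts →
  weighTree oo-node ts + weighTree el-node ts ≡ weighTree ee-node ts + weighTree odd-node ts
weighTree-ooel ts = begin
  weighTree oo-node ts + weighTree el-node ts
    ≡⟨ weighTree-⊕ oo-node el-node ts ⟨
  weighTree (oo-node ⊕ el-node) ts
    ≡⟨ weighTree-cong (≗-by-cases (oo-node ⊕ el-node) (ee-node ⊕ odd-node) refl refl refl refl) ts ⟩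
  weighTree (ee-node ⊕ odd-node) ts
    ≡⟨ weighTree-⊕ ee-node odd-node ts ⟩
  weighTree ee-node ts + weighTree odd-node ts
    ∎
  where open ≡-Reasoning

weighTree-any : ∀ ts →
  weighTree any-node ts ≡ weighTree ee-node ts + (weighTree oe-node ts + weighTree odd-node ts)
weighTree-any ts = begin
  weighTree any-node ts
    ≡⟨ weighTree-cong (≗-by-cases any-node (ee-node ⊕ (oe-node ⊕ odd-node)) refl refl refl refl) ts ⟩
  weighTree (ee-node ⊕ (oe-node ⊕ odd-node)) ts
    ≡⟨ weighTree-⊕ ee-node (oe-node ⊕ odd-node) ts ⟩
  weighTree ee-node ts + weighTree (oe-node ⊕ odd-node) ts
    ≡⟨ cong (weighTree ee-node ts +_) (weighTree-⊕ oe-node odd-node ts) ⟩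
  weighTree ee-node ts + (weighTree oe-node ts + weighTree odd-node ts)
    ∎
  where open ≡-Reasoning

b2n-xor : ∀ x y → x xor y ≡ true → b2n x + b2n y ≡ b2n (not x) + b2n (not y)
b2n-xor true  false _ = refl
b2n-xor false true  _ = refl

mutual
  φ-oe : ∀ ts → weigh oe-node false (φ ts) ≡ weighTree odd-node ts
  φ-oe [] = refl
  φ-oe (node w F ∷ []) with evenLength F in e
  ... | true  rewrite evenLength-φ↓ F | e | φ↓-oe F = refl
  ... | false rewrite φ⇄-oe F | e | +-identityʳ (weigh odd-node true F) = refl
  φ-oe (node w F₁ ∷ node w₂ F₂ ∷ R) with evenLength F₁ xor evenLength F₂ in d
  ... | true
    -- F₁ and F₂ have opposite parities, so exactly one of w, w₂ has even degree.
    rewrite evenLength-φ↓ F₁ | evenLength-φ↓ F₂ | φ↓-oe F₁ | φ↓-oe F₂ | φ-oe R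
          | not-involutive (evenLength R) =
    regroup (b2n (evenLength F₁)) (b2n (evenLength F₂))
            (b2n (not (evenLength F₁))) (b2n (not (evenLength F₂)))
            (weigh odd-node true F₁) (weigh odd-node true F₂)
            (b2n (not (evenLength R))) (weigh odd-node false R)
            (b2n-xor (evenLength F₁) (evenLength F₂) d)
    where
    regroup : ∀ x₁ x₂ y₁ y₂ o₁ o₂ r o → x₁ + x₂ ≡ y₁ + y₂ →
      (x₁ + o₁) + ((x₂ + o₂) + (r + o)) ≡ r + ((y₁ + o₁) + ((y₂ + o₂) + o))
    regroup x₁ x₂ y₁ y₂ o₁ o₂ r o x≡y = begin
      (x₁ + o₁) + ((x₂ + o₂) + (r + o)) ≡⟨ solve (x₁ ∷ x₂ ∷ o₁ ∷ o₂ ∷ r ∷ o ∷ []) ⟩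
      (x₁ + x₂) + (r + (o₁ + (o₂ + o))) ≡⟨ cong (_+ (r + (o₁ + (o₂ + o)))) x≡y ⟩
      (y₁ + y₂) + (r + (o₁ + (o₂ + o))) ≡⟨ solve (y₁ ∷ y₂ ∷ o₁ ∷ o₂ ∷ r ∷ o ∷ []) ⟩
      r + ((y₁ + o₁) + ((y₂ + o₂) + o)) ∎
      where open ≡-Reasoning
  ... | false
    rewrite evenLength-φ↓ F₂ | φ↓-oe F₂ | φ-oe R | φ⇄-oe F₁
          | not-involutive (evenLength R) =
    regroup (b2n (not (evenLength F₁))) (b2n (not (evenLength F₂))) (b2n (not (evenLength R)))
            (weigh odd-node true F₁) (weigh odd-node true F₂) (weigh odd-node false R)
    where
    regroup : ∀ y₁ y₂ r o₁ o₂ o →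
      (y₂ + ((r + o) + o₂)) + (y₁ + o₁) ≡ r + ((y₁ + o₁) + ((y₂ + o₂) + o))
    regroup = solve-∀

  φ↓-oe : ∀ F → weigh oe-node true (φ↓ F) ≡ weigh odd-node true F
  φ↓-oe []             = refl
  φ↓-oe (node a C ∷ S) = cong₂ _+_ (φ-oe C) (φ↓-oe S)

  φ⇄-oe : ∀ F → weigh oe-node false (φ⇄ F) ≡ b2n (not (evenLength F)) + weigh odd-node true F
  φ⇄-oe []             = refl
  φ⇄-oe (node a C ∷ S)
    rewrite evenLength-φ↓ S | φ↓-oe S | φ-oe C | not-involutive (evenLength S) =
    trans (+-assoc (b2n (evenLength S)) _ _)
          (cong (b2n (evenLength S) +_) (+-comm (weigh odd-node true S) (weighTree odd-node C)))

size : List Tree → ℕ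
size []             = 0
size (node a c ∷ s) = (1 + size c) + size s

weigh-any : ∀ l ts → weigh any-node l ts ≡ size ts
weigh-any l []             = refl
weigh-any l (node a c ∷ s) = cong₂ (λ x y → (1 + x) + y) (weigh-any (not l) c) (weigh-any l s)

φ-any : ∀ ts → weighTree any-node (φ ts) ≡ weighTree any-node ts
φ-any ts = cong suc (begin
  weigh any-node false (φ ts) ≡⟨ weigh-any false (φ ts) ⟩
  size (φ ts)                 ≡⟨ foldsLabels-≈ +-isCommutativeSemigroup {F = size} (λ _ _ _ → refl) (φ-≈ ts) ⟨
  size ts                     ≡⟨ weigh-any false ts ⟨
  weigh any-node false ts     ∎)
  where open ≡-Reasoning

φ-odd : ∀ ts → weighTree odd-node (φ ts) ≡ weighTree oe-node ts
φ-odd ts = trans (sym (φ-oe (φ ts))) (cong (weigh oe-node false) (φ-involutive ts))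

φ-ee : ∀ ts → weighTree ee-node (φ ts) ≡ weighTree ee-node ts
φ-ee ts = +-cancelʳ-≡ (OE ts + ODD ts) (EE (φ ts)) (EE ts) (begin
  EE (φ ts) + (OE ts + ODD ts)         ≡⟨ cong (EE (φ ts) +_) (+-comm (OE ts) (ODD ts)) ⟩
  EE (φ ts) + (ODD ts + OE ts)         ≡⟨ cong₂ (λ x y → EE (φ ts) + (x + y)) (φ-oe ts) (φ-odd ts) ⟨
  EE (φ ts) + (OE (φ ts) + ODD (φ ts)) ≡⟨ weighTree-any (φ ts) ⟨
  weighTree any-node (φ ts)            ≡⟨ φ-any ts ⟩
  weighTree any-node ts                ≡⟨ weighTree-any ts ⟩
  EE ts + (OE ts + ODD ts)             ∎)
  where
  open ≡-Reasoning
  EE OE ODD : List Tree → ℕ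
  EE  = weighTree ee-node
  OE  = weighTree oe-node
  ODD = weighTree odd-node

φ-even : ∀ ts → weighTree even-node (φ ts) ≡ weighTree oo-node ts + weighTree el-node ts
φ-even ts = begin
  weighTree even-node (φ ts)                          ≡⟨ weighTree-even (φ ts) ⟩
  weighTree ee-node (φ ts) + weighTree oe-node (φ ts) ≡⟨ cong₂ _+_ (φ-ee ts) (φ-oe ts) ⟩
  weighTree ee-node ts + weighTree odd-node ts        ≡⟨ weighTree-ooel ts ⟨
  weighTree oo-node ts + weighTree el-node ts         ∎
  where open ≡-Reasoning

φ-ooel : ∀ ts → weighTree oo-node (φ ts) + weighTree el-node (φ ts) ≡ weighTree even-node ts
φ-ooel ts = begin
  weighTree oo-node (φ ts) + weighTree el-node (φ ts)  ≡⟨ weighTree-ooel (φ ts) ⟩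
  weighTree ee-node (φ ts) + weighTree odd-node (φ ts) ≡⟨ cong₂ _+_ (φ-ee ts) (φ-odd ts) ⟩
  weighTree ee-node ts + weighTree oe-node ts          ≡⟨ weighTree-even ts ⟨
  weighTree even-node ts                               ∎
  where open ≡-Reasoning

WeighsBy : Weight → (Bool → List Tree → ℕ) → Set
WeighsBy w F = (∀ l → F l [] ≡ 0)
             × (∀ l a cs ts → F l (node a cs ∷ ts) ≡ (w l (isEven (length cs)) + F (not l) cs) + F l ts)

weighsBy⇒weigh : ∀ {w F} → WeighsBy w F → ∀ l ts → F l ts ≡ weigh w l ts
weighsBy⇒weigh (F-nil , F-cons) l [] = F-nil l
weighsBy⇒weigh {w} W@(F-nil , F-cons) l (node a cs ∷ ts) =
  trans (F-cons l a cs ts)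
        (cong₂ _+_ (cong₂ _+_ (cong (w l) (sym (evenLength≡isEven∘length cs)))
                              (weighsBy⇒weigh W (not l) cs))
                   (weighsBy⇒weigh W l ts))

weighsBy⇒weighTree : ∀ {w F} → WeighsBy w F → ∀ ts →
  w true (isEven (length ts)) + F false ts ≡ weighTree w ts
weighsBy⇒weighTree {w} W ts =
  cong₂ _+_ (cong (w true) (sym (evenLength≡isEven∘length ts))) (weighsBy⇒weigh W false ts)

even-weighTree : ∀ a ts → even (node a ts) ≡ weighTree even-node ts
even-weighTree a = weighsBy⇒weighTree {even-node} {λ _ → evenStF} ((λ _ → refl) , (λ _ _ _ _ → refl))

ee-weighTree : ∀ a ts → ee (node a ts) ≡ weighTree ee-node ts
ee-weighTree a = weighsBy⇒weighTree {ee-node} {eeAtF} ((λ _ → refl) , (λ _ _ _ _ → refl))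

ooel-weighTree : ∀ a ts → oo (node a ts) + el (node a ts) ≡ weighTree oo-node ts + weighTree el-node ts
ooel-weighTree a ts =
  cong₂ _+_ (weighsBy⇒weighTree {oo-node} {ooAtF} ((λ _ → refl) , (λ _ _ _ _ → refl)) ts)
            (weighsBy⇒weighTree {el-node} {elAtF} ((λ _ → refl) , (λ _ _ _ _ → refl)) ts)

ψ : Tree → Tree
ψ (node a ts) = node a (φ ts)

ψ-involutive : ∀ t → ψ (ψ t) ≡ t
ψ-involutive (node a ts) = cong (node a) (φ-involutive ts)

ψ-even : ∀ t → even (ψ t) ≡ oo t + el t
ψ-even (node a ts) =
  trans (even-weighTree a (φ ts)) (trans (φ-even ts) (sym (ooel-weighTree a ts)))

ψ-ooel : ∀ t → oo (ψ t) + el (ψ t) ≡ even t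
ψ-ooel (node a ts) =
  trans (ooel-weighTree a (φ ts)) (trans (φ-ooel ts) (sym (even-weighTree a ts)))

ψ-ee : ∀ t → ee (ψ t) ≡ ee t
ψ-ee (node a ts) = trans (ee-weighTree a (φ ts)) (trans (φ-ee ts) (sym (ee-weighTree a ts)))

ψ-weaklyIncreasing : ∀ t → T (weaklyIncreasing t) → T (weaklyIncreasing (ψ t))
ψ-weaklyIncreasing (node a ts) incr =
  Heap⇒increasing a (φ ts) (Heap-≈ (φ-≈ ts) (increasing⇒Heap a ts incr))

ψ-countLabel : ∀ ℓ t → countLabel ℓ (ψ t) ≡ countLabel ℓ t
ψ-countLabel ℓ (node a ts) = cong ((if a ≡ᵇ ℓ then 1 else 0) +_)
  (sym (foldsLabels-≈ +-isCommutativeSemigroup {F = countLabelF ℓ} (λ _ _ _ → refl) (φ-≈ ts)))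

ψ-labelsBelow : ∀ n t → labelsBelow n (ψ t) ≡ labelsBelow n t
ψ-labelsBelow n (node a ts) = cong ((a ≤ᵇ n) ∧_)
  (sym (foldsLabels-≈ ∧-isCommutativeSemigroup {F = labelsBelowF n} (λ _ _ _ → refl) (φ-≈ ts)))
  where open IsCommutativeMonoid ∧-isCommutativeMonoid
          using () renaming (isCommutativeSemigroup to ∧-isCommutativeSemigroup)

allB-cong : ∀ {f g : ℕ → Bool} → (∀ x → f x ≡ g x) → ∀ xs → allB f xs ≡ allB g xs
allB-cong f≗g []       = refl
allB-cong f≗g (x ∷ xs) = cong₂ _∧_ (f≗g x) (allB-cong f≗g xs)

ψ-inTM : ∀ n p t → T (inTM n p t) → T (inTM n p (ψ t))
ψ-inTM n p t t∈ =
  let (incr , labels) = ∧-elim {weaklyIncreasing t} t∈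
  in ∧-intro (ψ-weaklyIncreasing t incr) (subst T (sym same-labels) labels)
  where
  same-labels : labelsBelow n (ψ t) ∧ allB (λ ℓ → countLabel ℓ (ψ t) ≡ᵇ multiplicity n p ℓ) (upTo (suc n))
              ≡ labelsBelow n t ∧ allB (λ ℓ → countLabel ℓ t ≡ᵇ multiplicity n p ℓ) (upTo (suc n))
  same-labels = cong₂ _∧_ (ψ-labelsBelow n t)
    (allB-cong (λ ℓ → cong (_≡ᵇ multiplicity n p ℓ) (ψ-countLabel ℓ t)) (upTo (suc n)))

×-irrelevant : {A B : Set} → Irrelevant A → Irrelevant B → Irrelevant (A × B)
×-irrelevant A-irr B-irr (a , b) (a′ , b′) = cong₂ _,_ (A-irr a a′) (B-irr b b′)

↔-by-involution : {A : Set} {P Q : A → Set} (f : A → A) → (∀ x → f (f x) ≡ x) →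
  (∀ {x} → Irrelevant (P x)) → (∀ {x} → Irrelevant (Q x)) →
  (∀ {x} → P x → Q (f x)) → (∀ {x} → Q x → P (f x)) → Σ A P ↔ Σ A Q
↔-by-involution f f-inv P-irr Q-irr P⇒Q Q⇒P = mk↔ₛ′
  (λ (x , p) → f x , P⇒Q p)
  (λ (x , q) → f x , Q⇒P q)
  (λ (x , q) → Σ-≡,≡→≡ (f-inv x , Q-irr _ q))
  (λ (x , p) → Σ-≡,≡→≡ (f-inv x , P-irr _ p))

corollary2p2 : (n : ℕ) (p : Fin n → ℕ) → (∀ i → 1 ≤ p i) →
    (a b c : ℕ) → LHSClass n p a b c ↔ RHSClass n p a b c
corollary2p2 n p _ a b c =
  ↔-by-involution ψ ψ-involutive class-irrelevant class-irrelevant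
    (λ {t} (t∈ , even≡ , ooel≡ , ee≡) →
       ψ-inTM n p t t∈ , trans (ψ-ooel t) even≡ , trans (ψ-even t) ooel≡ , trans (ψ-ee t) ee≡)
    (λ {t} (t∈ , ooel≡ , even≡ , ee≡) →
       ψ-inTM n p t t∈ , trans (ψ-even t) ooel≡ , trans (ψ-ooel t) even≡ , trans (ψ-ee t) ee≡)
  where
  class-irrelevant : ∀ {b : Bool} {x y z u v w : ℕ} → Irrelevant (T b × x ≡ y × z ≡ u × v ≡ w)
  class-irrelevant = ×-irrelevant T-irrelevant
                       (×-irrelevant ≡-irrelevant (×-irrelevant ≡-irrelevant ≡-irrelevant))
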